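{- Let $n\ge 1$ and let $F_n$ be the fan graph with vertices $v_0,v_1,\dots,v_{2n}$, where $v_0$ is adjacent to every $v_i$ ($1\le i\le 2n$) and, for each $j=1,\dots,n$, $v_{2j-1}$ is adjacent to $v_{2j}$ (no other edges). Let $\mathbf r=(r_0,r_1,\dots,r_{2n})$ be a primitive vector of positive integers. Then $\mathbf r$ is an arithmetical $r$-structure on $F_n$ if and only if $r_0 \mid r_1+r_2+\cdots+r_{2n}$; $r_i \mid r_0+r_{i+1}$ for every odd $i$ with $1\le i\le 2n-1$; and $r_i\mid r_0+r_{i-1}$ for every even $i$ with $2\le i\le 2n$.
   Context: For a finite connected graph $G$ with adjacency matrix $A$, an arithmetical structure on $G$ is a pair $(\mathbf d,\mathbf r)$ of vectors of positive integers indexed by the vertices such that $\mathbf r$ is primitive (the gcd of its entries is $1$) and $(\mathrm{diag}(\mathbf d)-A)\mathbf r=0$. A vector $\mathbf r$ is an arithmetical $r$-structure if there is a (necessarily unique) $\mathbf d$ with $(\mathbf d,\mathbf r)$ an arithmetical structure. -}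

module Defs where

open import Data.Nat using (ℕ; zero; suc; _+_; _*_; _<_; _%_; _≡ᵇ_)
open import Data.Nat.GCD using (gcd)
open import Data.Fin using (Fin; toℕ)
open import Data.List using (List; foldr; tabulate)
open import Data.Nat.ListAction using (sum)
open import Data.Bool using (Bool; true; false; _∧_; _∨_; if_then_else_)
open import Data.Product using (Σ; _×_)
open import Relation.Binary.PropositionalEquality using (_≡_)

-- A graph on m vertices given by its (ℕ-valued, symmetric) adjacency matrix.
AdjMatrix : ℕ → Set
AdjMatrix m = Fin m → Fin m → ℕ

gcdVec : ∀ {m} → (Fin m → ℕ) → ℕ
gcdVec r = foldr gcd 0 (tabulate r)

Primitive : ∀ {m} → (Fin m → ℕ) → Set
Primitive r = gcdVec r ≡ 1

Positive : ∀ {m} → (Fin m → ℕ) → Set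
Positive {m} v = ∀ (i : Fin m) → 0 < v i

matVec : ∀ {m} → AdjMatrix m → (Fin m → ℕ) → Fin m → ℕ
matVec A r i = sum (tabulate (λ j → A i j * r j))

-- (diag(d) - A) r = 0, written entrywise as d_i r_i = (A r)_i (over ℕ)
IsArithmeticalStructure : ∀ {m} → AdjMatrix m → (Fin m → ℕ) → (Fin m → ℕ) → Set
IsArithmeticalStructure {m} A d r =
  Positive d × Positive r × Primitive r × (∀ (i : Fin m) → d i * r i ≡ matVec A r i)

IsArithmeticalRStructure : ∀ {m} → AdjMatrix m → (Fin m → ℕ) → Set
IsArithmeticalRStructure {m} A r = Σ (Fin m → ℕ) (λ d → IsArithmeticalStructure A d r)

-- For a, b ≥ 1, write a = a' + 1, b = b' + 1; then {a, b} = {2j-1, 2j}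
-- iff (a' even and b' = a' + 1) or (b' even and a' = b' + 1).
fanEdge : ℕ → ℕ → Bool
fanEdge zero zero = false
fanEdge zero (suc _) = true
fanEdge (suc _) zero = true
fanEdge (suc a) (suc b) =
  ((a % 2 ≡ᵇ 0) ∧ (b ≡ᵇ suc a)) ∨ ((b % 2 ≡ᵇ 0) ∧ (a ≡ᵇ suc b))

-- Adjacency matrix of F_n, vertices Fin (2n+1) with index i standing for v_i.
fanAdj : (n : ℕ) → AdjMatrix (suc (2 * n))
fanAdj n i j = if fanEdge (toℕ i) (toℕ j) then 1 else 0

{-# OPTIONS --safe #-}
-- Row i of (diag d − A) r = 0 says d_i r_i = (A r)_i, so a positive primitive r is an
-- r-structure exactly when every r_i divides (A r)_i; the quotients are then forced to be d,
-- and they are positive because (A r)_i > 0. On the fan, (A r)_0 = r_1 + ⋯ + r_{2n}, and for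
-- i ≥ 1, (A r)_i = r_0 + r_{i'}, where v_{i'} is the other end of the blade v_{2j-1}v_{2j}
-- containing v_i.
module Submission where

open import Defs
open import Data.Nat using (ℕ; zero; suc; _+_; _*_; _≤_; _%_)
open import Data.Nat.Divisibility using (_∣_)
open import Data.Fin using (Fin; toℕ)
open import Data.List using (tabulate)
open import Data.Nat.ListAction using (sum)
open import Data.Product using (_×_)
open import Function.Bundles using (_⇔_)
open import Relation.Binary.PropositionalEquality using (_≡_)

open import Data.Bool using (true; false; T; _∧_; if_then_else_)
open import Data.Bool.Properties using (T-∧; T-∨)
open import Data.Fin using (fromℕ<)
open import Data.Fin.Properties using (toℕ<n; toℕ-fromℕ<; toℕ-injective)
import Data.Fin.Properties as Finₚ
open import Data.List.Properties using (tabulate-cong)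
open import Data.Nat using (_<_; _≡ᵇ_; z≤n; s≤s; >-nonZero; >-nonZero⁻¹)
open import Data.Nat.DivMod using (m*n%n≡0)
open import Data.Nat.Divisibility using (divides; quotient; quotient≢0)
open import Data.Nat.Properties
  using (≡ᵇ⇒≡; ≡⇒≡ᵇ; suc-injective; *-comm; *-identityˡ; +-identityʳ; m≤m+n; <-≤-trans; <-irrefl)
open import Data.Product using (∃-syntax; _,_)
open import Data.Product.Function.NonDependent.Propositional using (_×-⇔_)
import Data.Product as Product
open import Data.Sum using (_⊎_; inj₁; inj₂)
import Data.Sum as Sum
open import Function using (_∘_; id)
open import Function.Bundles using (mk⇔; Equivalence)
open import Function.Construct.Composition using (_⇔-∘_)
open import Function.Construct.Identity using (⇔-id)
open import Relation.Nullary using (¬_; contradiction)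
open import Relation.Binary.PropositionalEquality using (_≢_; refl; sym; trans; cong; cong₂; subst; module ≡-Reasoning)

rStructure⇔divisibility : ∀ {m} (A : AdjMatrix m) {r : Fin m → ℕ} → Positive r → Primitive r →
  (∀ i → 0 < matVec A r i) → IsArithmeticalRStructure A r ⇔ (∀ i → r i ∣ matVec A r i)
rStructure⇔divisibility A {r} r>0 prim Ar>0 = mk⇔
  (λ (d , _ , _ , _ , dr≡Ar) i → divides (d i) (sym (dr≡Ar i)))
  (λ r∣Ar → (λ i → quotient (r∣Ar i)) , quotient>0 ∘ r∣Ar , r>0 , prim ,
            (λ i → sym (_∣_.equality (r∣Ar i))))
  where
  quotient>0 : ∀ {i} (r∣Ar : r i ∣ matVec A r i) → 0 < quotient r∣Ar
  quotient>0 {i} r∣Ar = >-nonZero⁻¹ _ {{quotient≢0 r∣Ar {{>-nonZero (Ar>0 i)}}}}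

sum-tabulate-zero : ∀ {m} (f : Fin m → ℕ) → (∀ j → f j ≡ 0) → sum (tabulate f) ≡ 0
sum-tabulate-zero {zero}  f f≡0 = refl
sum-tabulate-zero {suc m} f f≡0 = cong₂ _+_ (f≡0 Fin.zero) (sum-tabulate-zero (f ∘ Fin.suc) (f≡0 ∘ Fin.suc))

sum-tabulate-single : ∀ {m} (f : Fin m → ℕ) (k : Fin m) → (∀ j → j ≢ k → f j ≡ 0) →
  sum (tabulate f) ≡ f k
sum-tabulate-single f Fin.zero f≡0 =
  trans (cong (f Fin.zero +_) (sum-tabulate-zero (f ∘ Fin.suc) (λ j → f≡0 (Fin.suc j) λ ())))
        (+-identityʳ (f Fin.zero))
sum-tabulate-single f (Fin.suc k) f≡0 =
  cong₂ _+_ (f≡0 Fin.zero λ ())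
            (sum-tabulate-single (f ∘ Fin.suc) k (λ j j≢k → f≡0 (Fin.suc j) (j≢k ∘ Finₚ.suc-injective)))

even⇒suc-odd : ∀ n → n % 2 ≡ 0 → suc n % 2 ≡ 1
even⇒suc-odd zero          _      = refl
even⇒suc-odd (suc (suc n)) n-even = even⇒suc-odd n n-even

suc-odd⇒even : ∀ n → suc n % 2 ≡ 1 → n % 2 ≡ 0
suc-odd⇒even zero          _      = refl
suc-odd⇒even (suc (suc n)) n-odd = suc-odd⇒even n n-odd

2*n-even : ∀ n → 2 * n % 2 ≡ 0
2*n-even n = trans (cong (_% 2) (*-comm 2 n)) (m*n%n≡0 n 2)

-- BladePartners a b: v_{1+a} and v_{1+b} are the two ends of one blade v_{2j-1}v_{2j}.
BladePartners : ℕ → ℕ → Set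
BladePartners a b = (a % 2 ≡ 0 × b ≡ suc a) ⊎ (b % 2 ≡ 0 × a ≡ suc b)

fanEdge⇔BladePartners : ∀ a b → T (fanEdge (suc a) (suc b)) ⇔ BladePartners a b
fanEdge⇔BladePartners a b = mk⇔
  (Sum.map both-≡ᵇ⇒≡ both-≡ᵇ⇒≡ ∘ to T-∨)
  (from T-∨ ∘ Sum.map both-≡⇒≡ᵇ both-≡⇒≡ᵇ)
  where
  open Equivalence
  both-≡ᵇ⇒≡ : ∀ {x y u v} → T ((x ≡ᵇ y) ∧ (u ≡ᵇ v)) → x ≡ y × u ≡ v
  both-≡ᵇ⇒≡ = Product.map (≡ᵇ⇒≡ _ _) (≡ᵇ⇒≡ _ _) ∘ to T-∧
  both-≡⇒≡ᵇ : ∀ {x y u v} → x ≡ y × u ≡ v → T ((x ≡ᵇ y) ∧ (u ≡ᵇ v))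
  both-≡⇒≡ᵇ = from T-∧ ∘ Product.map (≡⇒≡ᵇ _ _) (≡⇒≡ᵇ _ _)

BladePartners-functional : ∀ {a b c} → BladePartners a b → BladePartners a c → b ≡ c
BladePartners-functional (inj₁ (_ , refl)) (inj₁ (_ , refl)) = refl
BladePartners-functional (inj₂ (_ , refl)) (inj₂ (_ , refl)) = refl
BladePartners-functional {c = c} (inj₁ (a-even , refl)) (inj₂ (c-even , refl)) =
  contradiction (trans (sym (even⇒suc-odd c c-even)) a-even) λ ()
BladePartners-functional {b = b} (inj₂ (b-even , refl)) (inj₁ (a-even , refl)) =
  contradiction (trans (sym (even⇒suc-odd b b-even)) a-even) λ ()

BladePartners-shift : ∀ {a b} → BladePartners a b → BladePartners (2 + a) (2 + b)
BladePartners-shift = Sum.map (Product.map id (cong (2 +_))) (Product.map id (cong (2 +_)))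

bladePartner-below : ∀ {a e} → e % 2 ≡ 0 → a < e → ∃[ b ] b < e × BladePartners a b
bladePartner-below {zero}  {suc zero}    () _
bladePartner-below {zero}  {suc (suc e)} _ _ = 1 , s≤s (s≤s z≤n) , inj₁ (refl , refl)
bladePartner-below {suc zero} {suc zero} _ (s≤s ())
bladePartner-below {suc zero} {suc (suc e)} _ _ = 0 , s≤s z≤n , inj₂ (refl , refl)
bladePartner-below {suc (suc a)} {suc (suc e)} e-even (s≤s (s≤s a<e))
  with b , b<e , partners ← bladePartner-below {a} {e} e-even a<e =
  2 + b , s≤s (s≤s b<e) , BladePartners-shift partners

bladePartner : ∀ n (a : Fin (2 * n)) → ∃[ k ] BladePartners (toℕ a) (toℕ k)
bladePartner n a with b , b<2n , partners ← bladePartner-below (2*n-even n) (toℕ<n a) =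
  fromℕ< b<2n , subst (BladePartners (toℕ a)) (sym (toℕ-fromℕ< b<2n)) partners

module Fan (n : ℕ) (r : Fin (suc (2 * n)) → ℕ) where

  indicator-T : ∀ {b} → T b → (if b then 1 else 0) ≡ 1
  indicator-T {true} _ = refl

  indicator-¬T : ∀ {b} → ¬ T b → (if b then 1 else 0) ≡ 0
  indicator-¬T {true}  ¬t = contradiction _ ¬t
  indicator-¬T {false} _  = refl

  hub-row : matVec (fanAdj n) r Fin.zero ≡ sum (tabulate (λ (i : Fin (2 * n)) → r (Fin.suc i)))
  hub-row = cong sum (tabulate-cong (λ i → *-identityˡ (r (Fin.suc i))))

  blade-row : ∀ {a k} → BladePartners (toℕ a) (toℕ k) →
    matVec (fanAdj n) r (Fin.suc a) ≡ r Fin.zero + r (Fin.suc k)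
  blade-row {a} {k} partners = cong₂ _+_ (*-identityˡ (r Fin.zero)) (begin
    sum (tabulate λ j → fanAdj n (Fin.suc a) (Fin.suc j) * r (Fin.suc j))
      ≡⟨ sum-tabulate-single _ k (λ j j≢k → cong (_* r (Fin.suc j)) (off-blade j≢k)) ⟩
    fanAdj n (Fin.suc a) (Fin.suc k) * r (Fin.suc k)
      ≡⟨ cong (_* r (Fin.suc k)) (indicator-T (from (fanEdge⇔BladePartners _ _) partners)) ⟩
    1 * r (Fin.suc k)
      ≡⟨ *-identityˡ _ ⟩
    r (Fin.suc k) ∎)
    where
    open ≡-Reasoning
    open Equivalence
    off-blade : ∀ {j} → j ≢ k → fanAdj n (Fin.suc a) (Fin.suc j) ≡ 0
    off-blade j≢k = indicator-¬T λ edge →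
      j≢k (toℕ-injective (BladePartners-functional (to (fanEdge⇔BladePartners _ _) edge) partners))

  row>0 : 1 ≤ n → Positive r → ∀ i → 0 < matVec (fanAdj n) r i
  row>0 (s≤s z≤n) r>0 Fin.zero =
    subst (0 <_) (sym hub-row) (<-≤-trans (r>0 (Fin.suc Fin.zero)) (m≤m+n _ _))
  row>0 _ r>0 (Fin.suc a) with k , partners ← bladePartner n a =
    subst (0 <_) (sym (blade-row partners)) (<-≤-trans (r>0 Fin.zero) (m≤m+n _ _))

  HubCondition : Set
  HubCondition = r Fin.zero ∣ sum (tabulate (λ (i : Fin (2 * n)) → r (Fin.suc i)))

  BladeCondition : Set
  BladeCondition = ∀ (a k : Fin (2 * n)) → BladePartners (toℕ a) (toℕ k) →
    r (Fin.suc a) ∣ r Fin.zero + r (Fin.suc k)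

  OddCondition : Set
  OddCondition = ∀ (i j : Fin (suc (2 * n))) → toℕ i % 2 ≡ 1 → toℕ j ≡ suc (toℕ i) →
    r i ∣ r Fin.zero + r j

  EvenCondition : Set
  EvenCondition = ∀ (i j : Fin (suc (2 * n))) → toℕ i % 2 ≡ 0 → 2 ≤ toℕ i → toℕ i ≡ suc (toℕ j) →
    r i ∣ r Fin.zero + r j

  divisibility⇔hub×blade : (∀ i → r i ∣ matVec (fanAdj n) r i) ⇔ (HubCondition × BladeCondition)
  divisibility⇔hub×blade = mk⇔
    (λ r∣Ar → subst (r Fin.zero ∣_) hub-row (r∣Ar Fin.zero) ,
              λ a k partners → subst (r (Fin.suc a) ∣_) (blade-row partners) (r∣Ar (Fin.suc a)))
    (λ (hub , blade) → λ where
      Fin.zero → subst (r Fin.zero ∣_) (sym hub-row) hub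
      (Fin.suc a) → let k , partners = bladePartner n a in
        subst (r (Fin.suc a) ∣_) (sym (blade-row partners)) (blade a k partners))

  blade⇔odd×even : BladeCondition ⇔ (OddCondition × EvenCondition)
  blade⇔odd×even = mk⇔ (λ blade → odd blade , even blade) blade
    where
    odd : BladeCondition → OddCondition
    odd blade (Fin.suc a) (Fin.suc k) i-odd j≡1+i =
      blade a k (inj₁ (suc-odd⇒even (toℕ a) i-odd , suc-injective j≡1+i))

    even : BladeCondition → EvenCondition
    even blade (Fin.suc a) Fin.zero _ 2≤i i≡1 = contradiction (subst (2 ≤_) i≡1 2≤i) (<-irrefl refl)
    even blade (Fin.suc a) (Fin.suc k) i-even _ i≡1+j =
      blade a k (inj₂ (subst (λ x → suc x % 2 ≡ 0) (suc-injective i≡1+j) i-even , suc-injective i≡1+j))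

    blade : OddCondition × EvenCondition → BladeCondition
    blade (odd , _) a k (inj₁ (a-even , k≡1+a)) =
      odd (Fin.suc a) (Fin.suc k) (even⇒suc-odd (toℕ a) a-even) (cong suc k≡1+a)
    blade (_ , even) a k (inj₂ (k-even , a≡1+k)) =
      even (Fin.suc a) (Fin.suc k) (subst (λ x → suc x % 2 ≡ 0) (sym a≡1+k) k-even)
        (subst (λ x → 2 ≤ suc x) (sym a≡1+k) (s≤s (s≤s z≤n))) (cong suc a≡1+k)

mainTheorem1 : (n : ℕ) → 1 ≤ n → (r : Fin (suc (2 * n)) → ℕ) →
    Positive r → Primitive r →
    IsArithmeticalRStructure (fanAdj n) r ⇔
      ((r Fin.zero ∣ sum (tabulate (λ (i : Fin (2 * n)) → r (Fin.suc i))))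
      × (∀ (i j : Fin (suc (2 * n))) → toℕ i % 2 ≡ 1 → toℕ j ≡ suc (toℕ i) →
           r i ∣ r Fin.zero + r j)
      × (∀ (i j : Fin (suc (2 * n))) → toℕ i % 2 ≡ 0 → 2 ≤ toℕ i → toℕ i ≡ suc (toℕ j) →
           r i ∣ r Fin.zero + r j))
mainTheorem1 n 1≤n r r>0 prim =
  ((⇔-id _ ×-⇔ blade⇔odd×even) ⇔-∘ divisibility⇔hub×blade) ⇔-∘
    rStructure⇔divisibility (fanAdj n) r>0 prim (row>0 1≤n r>0)
  where open Fan n r
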